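{- For any graphs $G$ and $H$ with no isolated vertex, $$\gamma_{R}(G\times H)\leq \min\{\gamma(G)(n(H)+\gamma_{t}(H)),\ \gamma(H)(n(G)+\gamma_{t}(G))\}.$$
   Context: All graphs are finite and simple; $n(G)=|V(G)|$. The direct product $G\times H$ has vertex set $V(G)\times V(H)$, with $(u,v)$ adjacent to $(u',v')$ iff $uu'\in E(G)$ and $vv'\in E(H)$. $\gamma(G)$ is the domination number (minimum size of a set $S$ with every vertex in $S$ or adjacent to $S$); $\gamma_t(G)$ is the total domination number (minimum size of a set $D$ such that every vertex has a neighbor in $D$). A Roman dominating function on $G$ is $f:V(G)\to\{0,1,2\}$ such that every vertex with value $0$ has a neighbor with value $2$; $\gamma_R(G)$ is the minimum of $\sum_v f(v)$ over such $f$. -}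

module Defs where

open import Data.Nat using (ℕ; _+_; _*_; _≤_)
open import Data.Bool using (Bool; true; false; _∧_)
open import Data.Fin using (Fin; quotient; remainder)
open import Data.Fin.Subset using (Subset; _∈_; ∣_∣)
open import Data.Vec using (tabulate; sum)
open import Data.Product using (Σ; ∃; _×_; _,_)
open import Data.Sum using (_⊎_)
open import Relation.Binary.PropositionalEquality using (_≡_)
open import Relation.Nullary using (¬_)

record Graph : Set where
  field
    n     : ℕ
    adj   : Fin n → Fin n → Bool
    sym   : ∀ u v → adj u v ≡ adj v u
    irrefl : ∀ v → adj v v ≡ false
open Graph public

Adj : (G : Graph) → Fin (n G) → Fin (n G) → Set
Adj G u v = adj G u v ≡ true

NoIsolated : Graph → Set
NoIsolated G = ∀ v → ∃ λ u → Adj G v u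

-- Direct (tensor) product; vertex (u , v) is encoded as combine u v : Fin (n G * n H),
-- decoded by quotient / remainder.
-- first and second coordinates of a product vertex
fstV : (G H : Graph) → Fin (n G * n H) → Fin (n G)
fstV G H x = quotient {n G} (n H) x

sndV : (G H : Graph) → Fin (n G * n H) → Fin (n H)
sndV G H x = remainder {n G} (n H) x

_×ᵍ_ : Graph → Graph → Graph
G ×ᵍ H = record
  { n = n G * n H
  ; adj = λ x y → adj G (fstV G H x) (fstV G H y)
                  ∧ adj H (sndV G H x) (sndV G H y)
  ; sym = λ x y → cong₂' (sym G _ _) (sym H _ _)
  ; irrefl = λ x → andFalse (irrefl G (fstV G H x))
  }
  where
  open import Relation.Binary.PropositionalEquality using (cong₂; refl)
  cong₂' : ∀ {a b c d : Bool} → a ≡ b → c ≡ d → (a ∧ c) ≡ (b ∧ d)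
  cong₂' p q = cong₂ _∧_ p q
  andFalse : ∀ {a b : Bool} → a ≡ false → (a ∧ b) ≡ false
  andFalse refl = refl

IsDominating : (G : Graph) → Subset (n G) → Set
IsDominating G S = ∀ v → v ∈ S ⊎ (∃ λ u → u ∈ S × Adj G v u)

IsTotalDominating : (G : Graph) → Subset (n G) → Set
IsTotalDominating G D = ∀ v → ∃ λ u → u ∈ D × Adj G v u

IsDominationNumber : Graph → ℕ → Set
IsDominationNumber G k =
  (Σ (Subset (n G)) λ S → IsDominating G S × ∣ S ∣ ≡ k)
  × (∀ S → IsDominating G S → k ≤ ∣ S ∣)

IsTotalDominationNumber : Graph → ℕ → Set
IsTotalDominationNumber G k =
  (Σ (Subset (n G)) λ D → IsTotalDominating G D × ∣ D ∣ ≡ k)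
  × (∀ D → IsTotalDominating G D → k ≤ ∣ D ∣)

open import Data.Fin using (zero; suc; toℕ)

IsRomanDominating : (G : Graph) → (Fin (n G) → Fin 3) → Set
IsRomanDominating G f =
  ∀ v → f v ≡ zero → ∃ λ u → Adj G v u × f u ≡ suc (suc zero)

weight : (G : Graph) → (Fin (n G) → Fin 3) → ℕ
weight G f = sum (tabulate (λ v → toℕ (f v)))

IsRomanDominationNumber : Graph → ℕ → Set
IsRomanDominationNumber G k =
  (Σ (Fin (n G) → Fin 3) λ f → IsRomanDominating G f × weight G f ≡ k)
  × (∀ f → IsRomanDominating G f → k ≤ weight G f)

-- Let S be a dominating set of G and D a total dominating set of H. Give (u , v) the
-- value 2 if u ∈ S and v ∈ D, the value 1 if u ∈ S and v ∉ D, and 0 otherwise. If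
-- u ∉ S, pick a neighbour s ∈ S of u and a neighbour d ∈ D of v: then (s , d) is a
-- neighbour of (u , v) with value 2, so this is a Roman dominating function on G × H
-- of weight |S| (n(H) + |D|). Exchanging the roles of G and H gives the other bound.
module Submission where

open import Defs hiding (sym)
open import Data.Nat using (ℕ; zero; suc; _+_; _*_; _≤_; _⊓_)
open import Data.Nat.Properties using (+-*-semiring; +-assoc; ⊓-glb)
open import Data.Bool using (Bool; true; false; _∧_)
open import Data.Fin using (Fin; zero; suc; toℕ; _↑ˡ_; _↑ʳ_; combine)
open import Data.Fin.Properties using (remQuot-combine)
open import Data.Fin.Subset using (Subset; ∣_∣)
open import Data.Vec as Vec using ([]; _∷_; tabulate; lookup)
open import Data.Vec.Properties using ([]=⇒lookup)
open import Data.Product using (∃; _×_; _,_; proj₁; proj₂)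
open import Data.Sum using (inj₁; inj₂)
open import Relation.Binary.PropositionalEquality
open import Relation.Nullary using (contradiction)
open import Algebra.Properties.Semiring.Sum +-*-semiring
  using (sum; sum-syntax; sum-cong-≗; ∑-distrib-+; *-distribˡ-sum; *-distribʳ-sum; ∑-comm)

open ≡-Reasoning

private
  variable
    m k : ℕ

sum-tabulate : (f : Fin m → ℕ) → Vec.sum (tabulate f) ≡ sum f
sum-tabulate {zero}  f = refl
sum-tabulate {suc m} f = cong (f zero +_) (sum-tabulate (λ i → f (suc i)))

∑-const-1 : ∀ m → ∑[ i < m ] 1 ≡ m
∑-const-1 zero    = refl
∑-const-1 (suc m) = cong suc (∑-const-1 m)

∑-splitAt : ∀ m k (f : Fin (m + k) → ℕ) →
            sum f ≡ ∑[ i < m ] f (i ↑ˡ k) + ∑[ j < k ] f (m ↑ʳ j)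
∑-splitAt zero    k f = refl
∑-splitAt (suc m) k f = begin
  f zero + sum (λ i → f (suc i))
    ≡⟨ cong (f zero +_) (∑-splitAt m k (λ i → f (suc i))) ⟩
  f zero + (∑[ i < m ] f (suc (i ↑ˡ k)) + ∑[ j < k ] f (suc m ↑ʳ j))
    ≡⟨ +-assoc (f zero) _ _ ⟨
  f zero + ∑[ i < m ] f (suc (i ↑ˡ k)) + ∑[ j < k ] f (suc m ↑ʳ j) ∎

∑-combine : ∀ m k (f : Fin (m * k) → ℕ) →
            sum f ≡ ∑[ i < m ] ∑[ j < k ] f (combine i j)
∑-combine zero    k f = refl
∑-combine (suc m) k f = begin
  sum f
    ≡⟨ ∑-splitAt k (m * k) f ⟩
  ∑[ j < k ] f (j ↑ˡ m * k) + ∑[ x < m * k ] f (k ↑ʳ x)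
    ≡⟨ cong (∑[ j < k ] f (j ↑ˡ m * k) +_) (∑-combine m k (λ x → f (k ↑ʳ x))) ⟩
  ∑[ i < suc m ] ∑[ j < k ] f (combine i j) ∎

∑-product : (a : Fin m → ℕ) (b : Fin k → ℕ) →
            ∑[ i < m ] ∑[ j < k ] (a i * b j) ≡ sum a * sum b
∑-product {m} {k} a b = begin
  ∑[ i < m ] ∑[ j < k ] (a i * b j) ≡⟨ sum-cong-≗ (λ i → *-distribˡ-sum (a i) b) ⟨
  ∑[ i < m ] (a i * sum b)          ≡⟨ *-distribʳ-sum (sum b) a ⟨
  sum a * sum b                     ∎

indicator : Bool → ℕ
indicator false = 0
indicator true  = 1

∣p∣≡∑indicator : (p : Subset m) → ∣ p ∣ ≡ ∑[ i < m ] indicator (lookup p i)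
∣p∣≡∑indicator []          = refl
∣p∣≡∑indicator (true  ∷ p) = cong suc (∣p∣≡∑indicator p)
∣p∣≡∑indicator (false ∷ p) = ∣p∣≡∑indicator p

∑-1+indicator : (p : Subset m) → ∑[ i < m ] (1 + indicator (lookup p i)) ≡ m + ∣ p ∣
∑-1+indicator {m} p = begin
  ∑[ i < m ] (1 + indicator (lookup p i))
    ≡⟨ ∑-distrib-+ (λ _ → 1) (λ i → indicator (lookup p i)) ⟩
  ∑[ i < m ] 1 + ∑[ i < m ] indicator (lookup p i)
    ≡⟨ cong₂ _+_ (∑-const-1 m) (sym (∣p∣≡∑indicator p)) ⟩
  m + ∣ p ∣ ∎

label : Bool → Bool → Fin 3
label false _     = zero
label true  false = suc zero
label true  true  = suc (suc zero)

toℕ-label : ∀ a b → toℕ (label a b) ≡ indicator a * (1 + indicator b)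
toℕ-label false _     = refl
toℕ-label true  false = refl
toℕ-label true  true  = refl

label≡0⇒false : ∀ {a b} → label a b ≡ zero → a ≡ false
label≡0⇒false {false}         _ = refl
label≡0⇒false {true} {false} ()
label≡0⇒false {true} {true}  ()

LiftsNeighbours : (P A B : Graph) → (Fin (n P) → Fin (n A)) → (Fin (n P) → Fin (n B)) → Set
LiftsNeighbours P A B π₁ π₂ =
  ∀ x {s d} → Adj A (π₁ x) s → Adj B (π₂ x) d → ∃ λ y → Adj P x y × π₁ y ≡ s × π₂ y ≡ d

label-isRomanDominating :
  (P A B : Graph) (π₁ : Fin (n P) → Fin (n A)) (π₂ : Fin (n P) → Fin (n B)) →
  LiftsNeighbours P A B π₁ π₂ → (S : Subset (n A)) (D : Subset (n B)) →
  IsDominating A S → IsTotalDominating B D →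
  IsRomanDominating P (λ x → label (lookup S (π₁ x)) (lookup D (π₂ x)))
label-isRomanDominating P A B π₁ π₂ lift S D dom tot x fx≡0
  with dom (π₁ x) | tot (π₂ x)
... | inj₁ π₁x∈S | _ = contradiction (trans (sym ([]=⇒lookup π₁x∈S)) (label≡0⇒false fx≡0)) λ ()
... | inj₂ (s , s∈S , x~s) | d , d∈D , x~d with lift x x~s x~d
... | y , x~y , refl , refl = y , x~y , cong₂ label ([]=⇒lookup s∈S) ([]=⇒lookup d∈D)

×ᵍ-lifts : (G H : Graph) → LiftsNeighbours (G ×ᵍ H) G H (fstV G H) (sndV G H)
×ᵍ-lifts G H x {s} {d} x~s x~d = combine s d , x~combine , fst≡s , snd≡d
  where
  fst≡s : fstV G H (combine s d) ≡ s
  fst≡s = cong proj₁ (remQuot-combine s d)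
  snd≡d : sndV G H (combine s d) ≡ d
  snd≡d = cong proj₂ (remQuot-combine s d)
  x~combine : Adj (G ×ᵍ H) x (combine s d)
  x~combine = trans (cong₂ (λ u v → adj G (fstV G H x) u ∧ adj H (sndV G H x) v) fst≡s snd≡d)
                    (cong₂ _∧_ x~s x~d)

×ᵍ-lifts-swapped : (G H : Graph) → LiftsNeighbours (G ×ᵍ H) H G (sndV G H) (fstV G H)
×ᵍ-lifts-swapped G H x x~d x~s with ×ᵍ-lifts G H x x~s x~d
... | y , x~y , fst≡s , snd≡d = y , x~y , snd≡d , fst≡s

weight-×ᵍ : (G H : Graph) (φ : Fin (n G) → Fin (n H) → Fin 3) →
            weight (G ×ᵍ H) (λ x → φ (fstV G H x) (sndV G H x))
              ≡ ∑[ u < n G ] ∑[ v < n H ] toℕ (φ u v)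
weight-×ᵍ G H φ = begin
  Vec.sum (tabulate f)                        ≡⟨ sum-tabulate f ⟩
  sum f                                       ≡⟨ ∑-combine (n G) (n H) f ⟩
  ∑[ u < n G ] ∑[ v < n H ] f (combine u v)   ≡⟨ sum-cong-≗ (λ u → sum-cong-≗ (λ v →
                                                   cong (λ p → toℕ (φ (proj₁ p) (proj₂ p)))
                                                        (remQuot-combine {n G} {n H} u v))) ⟩
  ∑[ u < n G ] ∑[ v < n H ] toℕ (φ u v)       ∎
  where
  f = λ x → toℕ (φ (fstV G H x) (sndV G H x))

∑∑-label : (S : Subset m) (D : Subset k) →
           ∑[ u < m ] ∑[ v < k ] toℕ (label (lookup S u) (lookup D v)) ≡ ∣ S ∣ * (k + ∣ D ∣)
∑∑-label {m} {k} S D = begin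
  ∑[ u < m ] ∑[ v < k ] toℕ (label (lookup S u) (lookup D v))
    ≡⟨ sum-cong-≗ (λ u → sum-cong-≗ (λ v → toℕ-label (lookup S u) (lookup D v))) ⟩
  ∑[ u < m ] ∑[ v < k ] (indicator (lookup S u) * (1 + indicator (lookup D v)))
    ≡⟨ ∑-product (λ u → indicator (lookup S u)) (λ v → 1 + indicator (lookup D v)) ⟩
  (∑[ u < m ] indicator (lookup S u)) * (∑[ v < k ] (1 + indicator (lookup D v)))
    ≡⟨ cong₂ _*_ (sym (∣p∣≡∑indicator S)) (∑-1+indicator D) ⟩
  ∣ S ∣ * (k + ∣ D ∣) ∎

module _ (G H : Graph) {r : ℕ} (γR : IsRomanDominationNumber (G ×ᵍ H) r) where

  γR≤∣S∣*[n[H]+∣D∣] : (S : Subset (n G)) (D : Subset (n H)) →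
    IsDominating G S → IsTotalDominating H D → r ≤ ∣ S ∣ * (n H + ∣ D ∣)
  γR≤∣S∣*[n[H]+∣D∣] S D dom tot = subst (r ≤_) weight≡ (proj₂ γR _ roman)
    where
    roman = label-isRomanDominating (G ×ᵍ H) G H (fstV G H) (sndV G H) (×ᵍ-lifts G H) S D dom tot
    weight≡ : weight (G ×ᵍ H) (λ x → label (lookup S (fstV G H x)) (lookup D (sndV G H x)))
              ≡ ∣ S ∣ * (n H + ∣ D ∣)
    weight≡ = trans (weight-×ᵍ G H (λ u v → label (lookup S u) (lookup D v))) (∑∑-label S D)

  γR≤∣S∣*[n[G]+∣D∣] : (S : Subset (n H)) (D : Subset (n G)) →
    IsDominating H S → IsTotalDominating G D → r ≤ ∣ S ∣ * (n G + ∣ D ∣)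
  γR≤∣S∣*[n[G]+∣D∣] S D dom tot = subst (r ≤_) weight≡ (proj₂ γR _ roman)
    where
    roman = label-isRomanDominating (G ×ᵍ H) H G (sndV G H) (fstV G H) (×ᵍ-lifts-swapped G H) S D dom tot
    weight≡ : weight (G ×ᵍ H) (λ x → label (lookup S (sndV G H x)) (lookup D (fstV G H x)))
              ≡ ∣ S ∣ * (n G + ∣ D ∣)
    weight≡ = begin
      _ ≡⟨ weight-×ᵍ G H (λ u v → label (lookup S v) (lookup D u)) ⟩
      ∑[ u < n G ] ∑[ v < n H ] toℕ (label (lookup S v) (lookup D u))
        ≡⟨ ∑-comm (λ u v → toℕ (label (lookup S v) (lookup D u))) ⟩
      ∑[ v < n H ] ∑[ u < n G ] toℕ (label (lookup S v) (lookup D u))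
        ≡⟨ ∑∑-label S D ⟩
      ∣ S ∣ * (n G + ∣ D ∣) ∎

-- NoIsolated only ensures that γt exists, which the γt hypotheses already provide.
theorem2p8 : (G H : Graph) → NoIsolated G → NoIsolated H →
    (gG gH tG tH r : ℕ) →
    IsDominationNumber G gG → IsDominationNumber H gH →
    IsTotalDominationNumber G tG → IsTotalDominationNumber H tH →
    IsRomanDominationNumber (G ×ᵍ H) r →
    r ≤ (gG * (n H + tH)) ⊓ (gH * (n G + tG))
theorem2p8 G H _ _ gG gH tG tH r
  ((SG , domG , refl) , _) ((SH , domH , refl) , _)
  ((DG , totG , refl) , _) ((DH , totH , refl) , _) γR =
  ⊓-glb (γR≤∣S∣*[n[H]+∣D∣] G H γR SG DH domG totH)
        (γR≤∣S∣*[n[G]+∣D∣] G H γR SH DG domH totG)
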